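{- Let $n\ge0$ be an integer, $n_1=\lceil n/2\rceil$, and suppose $g\in K a(\varpi^{n_1})$. Then $t(g)=\min(n_1-2l(g),\,-n_1)$.
   Context: $F$ is a non-archimedean local field of characteristic zero, $\mathfrak{o}$ its ring of integers, $\mathfrak{p}$ the maximal ideal, $\varpi$ a uniformizer. $G=\mathrm{GL}_2(F)$, $K=\mathrm{GL}_2(\mathfrak{o})$, $K_1(\mathfrak{p}^k)=\{\begin{smallmatrix} a&b\\c&d\end{smallmatrix}\in K: c\in\mathfrak{p}^k,\ a\in1+\mathfrak{p}^k\}$, $w=\begin{smallmatrix}0&1\\-1&0\end{smallmatrix}$, $a(y)=\mathrm{diag}(y,1)$, $n(x)=\begin{smallmatrix}1&x\\0&1\end{smallmatrix}$, $N=\{n(x)\}$, $Z$ the center. Every $h\in G$ lies in $ZNa(\varpi^t)wn(\varpi^{ -l}v)K_1(\mathfrak{p}^n)$ for a unique pair of integers $(t,l)$ with $0\le l\le n$ and some $v\in\mathfrak{o}^\times$; define $t(h)=t$ and $l(h)=l$ (these depend on $n$). -}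

module Defs where

open import Level using (Level; _⊔_) renaming (suc to lsuc)
open import Algebra.Bundles using (CommutativeRing)
open import Data.Nat as ℕ using (ℕ; zero; suc; ⌈_/2⌉)
open import Data.Integer as ℤ using (ℤ; +_; -[1+_])
open import Data.Maybe using (Maybe; just; nothing)
open import Data.List using (List)
open import Data.List.Relation.Unary.Any using (Any)
open import Data.Product using (Σ; ∃; _×_; _,_; proj₁)
open import Data.Unit using (⊤)
open import Data.Empty using (⊥)
open import Relation.Nullary using (¬_)
open import Relation.Binary.PropositionalEquality using (_≡_; refl) renaming (trans to ≡-trans; sym to ≡-sym)

-- ℤ ∪ {∞} : nothing = +∞
ℤ∞ : Set
ℤ∞ = Maybe ℤ

_+∞_ : ℤ∞ → ℤ∞ → ℤ∞
just a +∞ just b = just (a ℤ.+ b)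
_      +∞ _      = nothing

_≼_ : ℤ → ℤ∞ → Set
k ≼ nothing = ⊤
k ≼ just m  = k ℤ.≤ m

natCast : {c ℓ : Level} (R : CommutativeRing c ℓ) → ℕ → CommutativeRing.Carrier R
natCast R zero    = CommutativeRing.0# R
natCast R (suc m) = CommutativeRing._+_ R (CommutativeRing.1# R) (natCast R m)

record NALocalField (c ℓ : Level) : Set (lsuc (c ⊔ ℓ)) where
  field
    cring : CommutativeRing c ℓ
  open CommutativeRing cring public
  field
    nontrivial : ¬ (1# ≈ 0#)
    inverse    : (x : Carrier) → ¬ (x ≈ 0#) → Σ Carrier (λ y → x * y ≈ 1#)
    char0      : (m : ℕ) → ¬ (natCast cring (suc m) ≈ 0#)
    val        : Carrier → ℤ∞
    val-∞⇒0    : (x : Carrier) → val x ≡ nothing → x ≈ 0#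
    val-0⇒∞    : (x : Carrier) → x ≈ 0# → val x ≡ nothing
    val-resp   : {x y : Carrier} → x ≈ y → val x ≡ val y
    val-mul    : (x y : Carrier) → val (x * y) ≡ val x +∞ val y
    val-ultra  : (k : ℤ) (x y : Carrier) → k ≼ val x → k ≼ val y → k ≼ val (x + y)
    ϖ          : Carrier
    val-ϖ      : val ϖ ≡ just (+ 1)
    -- finite residue field: finitely many representatives of 𝔬/𝔭
    residueReps : List Carrier
    residueFinite : (x : Carrier) → (+ 0) ≼ val x →
                    Any (λ r → (+ 1) ≼ val (x - r)) residueReps
    complete   : (s : ℕ → Carrier) →
                 ((N : ℤ) → ∃ λ M → (m : ℕ) → M ℕ.≤ m → N ≼ val (s (suc m) - s m)) →
                 ∃ λ x → (N : ℤ) → ∃ λ M → (m : ℕ) → M ℕ.≤ m → N ≼ val (x - s m)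

module LF {c ℓ : Level} (F : NALocalField c ℓ) where
  open NALocalField F

  ϖ≉0 : ¬ (ϖ ≈ 0#)
  ϖ≉0 p with ≡-trans (≡-sym val-ϖ) (val-0⇒∞ ϖ p)
  ... | ()

  ϖ⁻¹ : Carrier
  ϖ⁻¹ = proj₁ (inverse ϖ ϖ≉0)

  pow : Carrier → ℕ → Carrier
  pow x zero    = 1#
  pow x (suc m) = x * pow x m

  ϖ^ : ℤ → Carrier
  ϖ^ (+ m)      = pow ϖ m
  ϖ^ -[1+ m ]   = pow ϖ⁻¹ (suc m)

  isUnit : Carrier → Set
  isUnit x = val x ≡ just (+ 0)

  record M2 : Set c where
    constructor mat
    field
      e11 e12 e21 e22 : Carrier
  open M2 public

  _·_ : M2 → M2 → M2
  mat a b c' d · mat a' b' c'' d' =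
    mat (a * a' + b * c'') (a * b' + b * d') (c' * a' + d * c'') (c' * b' + d * d')
  infixl 7 _·_

  _≈M_ : M2 → M2 → Set ℓ
  A ≈M B = (e11 A ≈ e11 B) × (e12 A ≈ e12 B) × (e21 A ≈ e21 B) × (e22 A ≈ e22 B)

  det : M2 → Carrier
  det A = e11 A * e22 A - e12 A * e21 A

  aM : Carrier → M2
  aM y = mat y 0# 0# 1#

  nM : Carrier → M2
  nM x = mat 1# x 0# 1#

  wM : M2
  wM = mat 0# 1# (- 1#) 0#

  zM : Carrier → M2
  zM z = mat z 0# 0# z

  inK : M2 → Set
  inK A = ((+ 0) ≼ val (e11 A)) × ((+ 0) ≼ val (e12 A)) ×
          ((+ 0) ≼ val (e21 A)) × ((+ 0) ≼ val (e22 A)) × isUnit (det A)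

  inK1 : ℕ → M2 → Set
  inK1 k A = inK A × ((+ k) ≼ val (e21 A)) × ((+ k) ≼ val (e11 A - 1#))

  inCell : ℕ → M2 → ℤ → ℕ → Carrier → Set (c ⊔ ℓ)
  inCell n h t l v =
    Σ Carrier λ z → Σ Carrier λ x → Σ M2 λ k →
      (¬ (z ≈ 0#)) × inK1 n k ×
      (h ≈M (zM z · nM x · aM (ϖ^ t) · wM · nM (ϖ^ (ℤ.- (+ l)) * v) · k))

  inKa : ℕ → M2 → Set (c ⊔ ℓ)
  inKa m h = Σ M2 λ k → inK k × (h ≈M (k · aM (ϖ^ (+ m))))

-- Write g = k a(ϖ^n₁) = z n(x) a(ϖ^t) w n(y) k₁ with k ∈ K,
-- k₁ ∈ K₁(𝔭ⁿ), y = ϖ^(-l) v, and let V = val z.  Comparing determinants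
-- gives 2V + t = n₁.  Comparing bottom rows expresses the bottom row
-- (c ϖ^n₁, d) of g as -z times (P, Q) = (e11 + y e21, e12 + y e22)(k₁).
-- Since k₁ ∈ K₁(𝔭ⁿ), P is integral (a unit if l < n) and val Q ≥ -l;
-- since y det k₁ = Q e11 k₁ - P e12 k₁ and c, d are integral with one of
-- them a unit, this forces V = max(l, n₁), whence t = n₁ - 2V is the claim.
module Submission where

open import Defs
open import Level using (Level)
open import Data.Nat as ℕ using (ℕ; ⌈_/2⌉)
open import Data.Integer as ℤ using (ℤ; +_)
open import Relation.Binary.PropositionalEquality using (_≡_)

open import Algebra.Bundles using (CommutativeRing)
open import Algebra.Solver.Ring.AlmostCommutativeRing
  using (fromCommutativeRing; _-Raw-AlmostCommutative⟶_)
open import Data.Nat as ℕ using (zero; suc)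
open import Data.Integer as ℤ using (-[1+_]; _⊖_; _◃_)
import Data.Integer.Properties as ℤP
import Data.Nat.Properties as ℕP
open import Data.Sign as Sign using (Sign)
open import Data.Maybe using (Maybe; just; nothing)
open import Data.Maybe.Properties using (just-injective)
open import Data.Product using (Σ; _,_; proj₁; proj₂)
open import Data.Sum using (_⊎_; inj₁; inj₂)
open import Data.Unit using (tt)
open import Data.Empty using (⊥-elim)
open import Relation.Nullary using (¬_; yes; no)
import Relation.Binary.PropositionalEquality as ≡

-- The ring solver of the library needs a coefficient ring mapping into the
-- target ring.  Taking ℤ as coefficients (via its canonical map into any
-- ring) lets the solver decide every commutative-ring identity with
-- integer coefficients, cancellations included.
module IntegerCoefficientSolver {c ℓ : Level} (R : CommutativeRing c ℓ) where
  open CommutativeRing R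
  open import Relation.Binary.Reasoning.Setoid setoid
  open import Algebra.Properties.Ring ring
    using (-‿involutive; -‿distribˡ-*; -‿distribʳ-*; -‿+-comm; -0#≈0#)
  open import Algebra.Properties.Semiring.Mult.TCOptimised semiring
    using (_×_; 1+×; ×-homo-+; ×1-homo-*)

  -- The canonical map ℤ → R; it sends 1 to 1# and -1 to - 1# on the nose.
  embed : ℤ → Carrier
  embed (+ n)      = n × 1#
  embed -[1+ n ]   = - (suc n × 1#)

  signed : Sign → Carrier → Carrier
  signed Sign.+ x = x
  signed Sign.- x = - x

  signed-cong : ∀ s {x y} → x ≈ y → signed s x ≈ signed s y
  signed-cong Sign.+ p = p
  signed-cong Sign.- p = -‿cong p

  signed-* : ∀ s t x y → signed (s Sign.* t) (x * y) ≈ signed s x * signed t y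
  signed-* Sign.+ Sign.+ x y = refl
  signed-* Sign.+ Sign.- x y = -‿distribʳ-* x y
  signed-* Sign.- Sign.+ x y = -‿distribˡ-* x y
  signed-* Sign.- Sign.- x y = begin
    x * y            ≈⟨ *-congʳ (-‿involutive x) ⟨
    - (- x) * y      ≈⟨ -‿distribˡ-* (- x) y ⟨
    - (- x * y)      ≈⟨ -‿distribʳ-* (- x) y ⟩
    - x * - y        ∎

  embed-◃ : ∀ s n → embed (s ◃ n) ≈ signed s (n × 1#)
  embed-◃ Sign.+ zero    = refl
  embed-◃ Sign.- zero    = sym -0#≈0#
  embed-◃ Sign.+ (suc n) = refl
  embed-◃ Sign.- (suc n) = refl

  embed-sign-abs : ∀ i → embed i ≈ signed (ℤ.sign i) (ℤ.∣ i ∣ × 1#)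
  embed-sign-abs (+ n)    = refl
  embed-sign-abs -[1+ n ] = refl

  suc-difference : ∀ x y → (1# + x) - (1# + y) ≈ x - y
  suc-difference x y = begin
    (1# + x) + - (1# + y)      ≈⟨ +-congˡ (-‿+-comm 1# y) ⟨
    (1# + x) + (- 1# + - y)    ≈⟨ +-congʳ (+-comm 1# x) ⟩
    (x + 1#) + (- 1# + - y)    ≈⟨ +-assoc x 1# (- 1# + - y) ⟩
    x + (1# + (- 1# + - y))    ≈⟨ +-congˡ (+-assoc 1# (- 1#) (- y)) ⟨
    x + ((1# + - 1#) + - y)    ≈⟨ +-congˡ (+-congʳ (-‿inverseʳ 1#)) ⟩
    x + (0# + - y)             ≈⟨ +-congˡ (+-identityˡ (- y)) ⟩
    x - y                      ∎

  embed-⊖ : ∀ m n → embed (m ⊖ n) ≈ m × 1# - n × 1#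
  embed-⊖ zero    zero    = sym (trans (+-congˡ -0#≈0#) (+-identityʳ 0#))
  embed-⊖ (suc m) zero    = sym (trans (+-congˡ -0#≈0#) (+-identityʳ _))
  embed-⊖ zero    (suc n) = sym (+-identityˡ _)
  embed-⊖ (suc m) (suc n) = begin
    embed (suc m ⊖ suc n)       ≡⟨ ≡.cong embed (ℤP.[1+m]⊖[1+n]≡m⊖n m n) ⟩
    embed (m ⊖ n)               ≈⟨ embed-⊖ m n ⟩
    m × 1# - n × 1#             ≈⟨ suc-difference (m × 1#) (n × 1#) ⟨
    (1# + m × 1#) - (1# + n × 1#)
                                ≈⟨ +-cong (1+× m 1#) (-‿cong (1+× n 1#)) ⟨
    suc m × 1# - suc n × 1#     ∎

  embed-+ : ∀ i j → embed (i ℤ.+ j) ≈ embed i + embed j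
  embed-+ (+ m)    (+ n)    = ×-homo-+ 1# m n
  embed-+ (+ m)    -[1+ n ] = embed-⊖ m (suc n)
  embed-+ -[1+ m ] (+ n)    = trans (embed-⊖ n (suc m)) (+-comm _ _)
  embed-+ -[1+ m ] -[1+ n ] = begin
    - (suc (suc (m ℕ.+ n)) × 1#)         ≡⟨ ≡.cong (λ k → - (k × 1#)) (ℕP.+-suc (suc m) n) ⟨
    - ((suc m ℕ.+ suc n) × 1#)           ≈⟨ -‿cong (×-homo-+ 1# (suc m) (suc n)) ⟩
    - (suc m × 1# + suc n × 1#)          ≈⟨ -‿+-comm _ _ ⟨
    - (suc m × 1#) + - (suc n × 1#)      ∎

  embed-* : ∀ i j → embed (i ℤ.* j) ≈ embed i * embed j
  embed-* i j = begin
    embed (s ◃ ℤ.∣ i ∣ ℕ.* ℤ.∣ j ∣)                      ≈⟨ embed-◃ s (ℤ.∣ i ∣ ℕ.* ℤ.∣ j ∣) ⟩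
    signed s ((ℤ.∣ i ∣ ℕ.* ℤ.∣ j ∣) × 1#)                ≈⟨ signed-cong s (×1-homo-* ℤ.∣ i ∣ ℤ.∣ j ∣) ⟩
    signed s ((ℤ.∣ i ∣ × 1#) * (ℤ.∣ j ∣ × 1#))           ≈⟨ signed-* (ℤ.sign i) (ℤ.sign j) _ _ ⟩
    signed (ℤ.sign i) (ℤ.∣ i ∣ × 1#) * signed (ℤ.sign j) (ℤ.∣ j ∣ × 1#)
                                                          ≈⟨ *-cong (embed-sign-abs i) (embed-sign-abs j) ⟨
    embed i * embed j                                     ∎
    where s = ℤ.sign i Sign.* ℤ.sign j

  embed-neg : ∀ i → embed (ℤ.- i) ≈ - embed i
  embed-neg (+ zero)  = sym -0#≈0#
  embed-neg (+ suc n) = refl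
  embed-neg -[1+ n ]  = sym (-‿involutive _)

  embed-homomorphism : ℤ.+-*-rawRing -Raw-AlmostCommutative⟶ fromCommutativeRing R
  embed-homomorphism = record
    { ⟦_⟧ = embed ; +-homo = embed-+ ; *-homo = embed-* ; -‿homo = embed-neg
    ; 0-homo = refl ; 1-homo = refl }

  coefficient-equality : ∀ i j → Maybe (embed i ≈ embed j)
  coefficient-equality i j with i ℤ.≟ j
  ... | yes ≡.refl = just refl
  ... | no _       = nothing

  open import Algebra.Solver.Ring ℤ.+-*-rawRing (fromCommutativeRing R)
    embed-homomorphism coefficient-equality public

module ExtendedIntegers where
  ≼-resp : ∀ {k X Y} → X ≡ Y → k ≼ X → k ≼ Y
  ≼-resp ≡.refl k≼X = k≼X

  ≼-weaken : ∀ {j k} X → j ℤ.≤ k → k ≼ X → j ≼ X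
  ≼-weaken (just m) j≤k k≤m = ℤP.≤-trans j≤k k≤m
  ≼-weaken nothing  _   _   = tt

  ≼-+∞ : ∀ {j k} X Y → j ≼ X → k ≼ Y → (j ℤ.+ k) ≼ (X +∞ Y)
  ≼-+∞ (just x) (just y) j≤x k≤y = ℤP.+-mono-≤ j≤x k≤y
  ≼-+∞ (just x) nothing  _   _   = tt
  ≼-+∞ nothing  (just y) _   _   = tt
  ≼-+∞ nothing  nothing  _   _   = tt

  ≼-split : ∀ X → (+ 0) ≼ X → X ≡ just (+ 0) ⊎ (+ 1) ≼ X
  ≼-split nothing              _  = inj₂ tt
  ≼-split (just (+ zero))      _  = inj₁ ≡.refl
  ≼-split (just (+ suc m))     _  = inj₂ (ℤ.+≤+ (ℕ.s≤s ℕ.z≤n))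
  ≼-split (just -[1+ m ])      ()

  +∞-identityˡ : ∀ X → just (+ 0) +∞ X ≡ X
  +∞-identityˡ (just m) = ≡.cong just (ℤP.+-identityˡ m)
  +∞-identityˡ nothing  = ≡.refl

  +∞-identityʳ : ∀ X → X +∞ just (+ 0) ≡ X
  +∞-identityʳ (just m) = ≡.cong just (ℤP.+-identityʳ m)
  +∞-identityʳ nothing  = ≡.refl

  1≰0 : ¬ (+ 1 ℤ.≤ + 0)
  1≰0 (ℤ.+≤+ ())

module IntegerArithmetic where
  open import Data.Integer using (_+_; _-_; -_; _≤_; _⊓_)
  open import Data.Integer.Tactic.RingSolver using (solve-∀)
  open import Algebra.Properties.Ring ℤP.+-*-ring using (x+x≈x⇒x≈0)
  open ≡.≡-Reasoning

  i+i≡i⇒i≡0 : ∀ i → i + i ≡ i → i ≡ + 0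
  i+i≡i⇒i≡0 = x+x≈x⇒x≈0

  i+i≡0⇒i≡0 : ∀ i → i + i ≡ + 0 → i ≡ + 0
  i+i≡0⇒i≡0 (+ m)    eq = ≡.cong +_ (ℕP.m+n≡0⇒m≡0 m (ℤP.+-injective eq))
  i+i≡0⇒i≡0 -[1+ m ] ()

  minus-double-antitone : ∀ N {A B} → A ≤ B → N - (B + B) ≤ N - (A + A)
  minus-double-antitone N A≤B = ℤP.+-monoʳ-≤ N (ℤP.neg-mono-≤ (ℤP.+-mono-≤ A≤B A≤B))

  minus-double-self : ∀ N → N - (N + N) ≡ - N
  minus-double-self = solve-∀

  t-closed-form : ∀ (n₁ l : ℕ) (V t : ℤ) → (V + V) + t ≡ + n₁ →
    + l ≤ V → + n₁ ≤ V → V ≤ + l ⊎ V ≤ + n₁ →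
    t ≡ (+ n₁ - + (2 ℕ.* l)) ⊓ (- + n₁)
  t-closed-form n₁ l V t 2V+t≡n₁ l≤V n₁≤V V≤l⊎V≤n₁ = begin
      t                          ≡⟨ solve-t V t ⟩
      ((V + V) + t) - (V + V)    ≡⟨ ≡.cong (_- (V + V)) 2V+t≡n₁ ⟩
      N - (V + V)                ≡⟨ value-at-max V≤l⊎V≤n₁ ⟩
      (N - (L + L)) ⊓ (- N)      ≡⟨ ≡.cong (λ u → (N - u) ⊓ (- N)) 2l≡l+l ⟨
      (N - + (2 ℕ.* l)) ⊓ (- N)  ∎
    where
    N L : ℤ
    N = + n₁
    L = + l

    solve-t : ∀ V t → t ≡ ((V + V) + t) - (V + V)
    solve-t = solve-∀

    2l≡l+l : + (2 ℕ.* l) ≡ L + L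
    2l≡l+l = ≡.cong (λ k → + (l ℕ.+ k)) (ℕP.+-identityʳ l)

    value-at-max : V ≤ L ⊎ V ≤ N → N - (V + V) ≡ (N - (L + L)) ⊓ (- N)
    value-at-max (inj₁ V≤L) = begin
      N - (V + V)            ≡⟨ ≡.cong (λ u → N - (u + u)) (ℤP.≤-antisym V≤L l≤V) ⟩
      N - (L + L)            ≡⟨ ℤP.i≤j⇒i⊓j≡i N-2L≤-N ⟨
      (N - (L + L)) ⊓ (- N)  ∎
      where
      N-2L≤-N : N - (L + L) ≤ - N
      N-2L≤-N = ℤP.≤-trans (minus-double-antitone N (ℤP.≤-trans n₁≤V V≤L))
                           (ℤP.≤-reflexive (minus-double-self N))
    value-at-max (inj₂ V≤N) = begin
      N - (V + V)            ≡⟨ ≡.cong (λ u → N - (u + u)) (ℤP.≤-antisym V≤N n₁≤V) ⟩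
      N - (N + N)            ≡⟨ minus-double-self N ⟩
      - N                    ≡⟨ ℤP.i≥j⇒i⊓j≡j -N≤N-2L ⟨
      (N - (L + L)) ⊓ (- N)  ∎
      where
      -N≤N-2L : - N ≤ N - (L + L)
      -N≤N-2L = ℤP.≤-trans (ℤP.≤-reflexive (≡.sym (minus-double-self N)))
                           (minus-double-antitone N (ℤP.≤-trans l≤V V≤N))

module Valuation {c ℓ : Level} (F : NALocalField c ℓ) where
  open NALocalField F
  open LF F
  open ExtendedIntegers
  open IntegerArithmetic using (i+i≡i⇒i≡0; i+i≡0⇒i≡0)
  open IntegerCoefficientSolver cring using (solve; _:=_; _:+_; _:-_; con)
  open import Algebra.Properties.Ring ring using (-1*x≈-x; -‿involutive)
  open ≡.≡-Reasoning

  val-finite : ∀ x → ¬ (x ≈ 0#) → Σ ℤ λ m → val x ≡ just m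
  val-finite x x≉0 with val x in val-x
  ... | nothing = ⊥-elim (x≉0 (val-∞⇒0 x val-x))
  ... | just m  = m , ≡.refl

  -- val 1 = val 1 + val 1, and val 1 is finite.
  val-1 : val 1# ≡ just (+ 0)
  val-1 with val-finite 1# nontrivial
  ... | m , val-1≡m = ≡.trans val-1≡m (≡.cong just (i+i≡i⇒i≡0 m (just-injective m+m≡m)))
    where
    m+m≡m : just (m ℤ.+ m) ≡ just m
    m+m≡m = begin
      just m +∞ just m     ≡⟨ ≡.cong₂ _+∞_ val-1≡m val-1≡m ⟨
      val 1# +∞ val 1#     ≡⟨ val-mul 1# 1# ⟨
      val (1# * 1#)        ≡⟨ val-resp (*-identityˡ 1#) ⟩
      val 1#               ≡⟨ val-1≡m ⟩
      just m               ∎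

  -- (-1)² = 1 forces val (-1) = 0, hence val (- x) = val x.
  val-minus-one : val (- 1#) ≡ just (+ 0)
  val-minus-one with val (- 1#) | square
    where
    square : val (- 1#) +∞ val (- 1#) ≡ just (+ 0)
    square = begin
      val (- 1#) +∞ val (- 1#)  ≡⟨ val-mul (- 1#) (- 1#) ⟨
      val (- 1# * - 1#)         ≡⟨ val-resp (trans (-1*x≈-x (- 1#)) (-‿involutive 1#)) ⟩
      val 1#                    ≡⟨ val-1 ⟩
      just (+ 0)                ∎
  ... | just m  | m+m≡0 = ≡.cong just (i+i≡0⇒i≡0 m (just-injective m+m≡0))
  ... | nothing | ()

  val-neg : ∀ x → val (- x) ≡ val x
  val-neg x = begin
    val (- x)                ≡⟨ val-resp (sym (-1*x≈-x x)) ⟩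
    val (- 1# * x)           ≡⟨ val-mul (- 1#) x ⟩
    val (- 1#) +∞ val x      ≡⟨ ≡.cong (_+∞ val x) val-minus-one ⟩
    just (+ 0) +∞ val x      ≡⟨ +∞-identityˡ (val x) ⟩
    val x                    ∎

  val-*-unit : ∀ {u} x → isUnit u → val (x * u) ≡ val x
  val-*-unit {u} x u-unit = begin
    val (x * u)              ≡⟨ val-mul x u ⟩
    val x +∞ val u           ≡⟨ ≡.cong (val x +∞_) u-unit ⟩
    val x +∞ just (+ 0)      ≡⟨ +∞-identityʳ (val x) ⟩
    val x                    ∎

  val-*-≼ : ∀ {j k} x y → j ≼ val x → k ≼ val y → (j ℤ.+ k) ≼ val (x * y)
  val-*-≼ x y j≼x k≼y = ≼-resp (≡.sym (val-mul x y)) (≼-+∞ (val x) (val y) j≼x k≼y)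

  val-neg-≼ : ∀ {k} x → k ≼ val x → k ≼ val (- x)
  val-neg-≼ x = ≼-resp (≡.sym (val-neg x))

  ≼-val : ∀ {x m} → val x ≡ just m → m ≼ val x
  ≼-val val-x = ≼-resp (≡.sym val-x) ℤP.≤-refl

  -- Elements of 1 + 𝔭 are units: 1 = (1 + u) - u, and val 1 = 0.
  unit-plus : ∀ u → (+ 1) ≼ val u → isUnit (1# + u)
  unit-plus u u∈𝔭 with ≼-split (val (1# + u)) 1+u∈𝔬
    where
    1+u∈𝔬 : (+ 0) ≼ val (1# + u)
    1+u∈𝔬 = val-ultra (+ 0) 1# u (≼-val val-1) (≼-weaken (val u) (ℤ.+≤+ ℕ.z≤n) u∈𝔭)
  ... | inj₁ 1+u-unit = 1+u-unit
  ... | inj₂ 1+u∈𝔭    = ⊥-elim (1≰0 (≼-resp val-1 (≼-resp (val-resp one≈) 1∈𝔭)))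
    where
    1∈𝔭 : (+ 1) ≼ val ((1# + u) + - u)
    1∈𝔭 = val-ultra (+ 1) (1# + u) (- u) 1+u∈𝔭 (val-neg-≼ u u∈𝔭)
    one≈ : (1# + u) + - u ≈ 1#
    one≈ = solve 1 (λ u → (con (+ 1) :+ u) :- u := con (+ 1)) refl u

  val-ϖ⁻¹ : val ϖ⁻¹ ≡ just -[1+ 0 ]
  val-ϖ⁻¹ with val ϖ⁻¹ | ϖϖ⁻¹
    where
    ϖϖ⁻¹ : just (+ 1) +∞ val ϖ⁻¹ ≡ just (+ 0)
    ϖϖ⁻¹ = begin
      just (+ 1) +∞ val ϖ⁻¹  ≡⟨ ≡.cong (_+∞ val ϖ⁻¹) val-ϖ ⟨
      val ϖ +∞ val ϖ⁻¹       ≡⟨ val-mul ϖ ϖ⁻¹ ⟨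
      val (ϖ * ϖ⁻¹)          ≡⟨ val-resp (proj₂ (inverse ϖ ϖ≉0)) ⟩
      val 1#                 ≡⟨ val-1 ⟩
      just (+ 0)             ∎
  ... | just m  | 1+m≡0 =
    ≡.cong just (ℤP.i-j≡0⇒i≡j m -[1+ 0 ] (≡.trans (ℤP.+-comm m (+ 1)) (just-injective 1+m≡0)))
  ... | nothing | ()

  val-powϖ : ∀ m → val (pow ϖ m) ≡ just (+ m)
  val-powϖ zero    = val-1
  val-powϖ (suc m) = ≡.trans (val-mul ϖ (pow ϖ m)) (≡.cong₂ _+∞_ val-ϖ (val-powϖ m))

  val-powϖ⁻¹ : ∀ m → val (pow ϖ⁻¹ (suc m)) ≡ just -[1+ m ]
  val-powϖ⁻¹ zero    = ≡.trans (val-mul ϖ⁻¹ 1#) (≡.cong₂ _+∞_ val-ϖ⁻¹ val-1)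
  val-powϖ⁻¹ (suc m) = ≡.trans (val-mul ϖ⁻¹ _) (≡.cong₂ _+∞_ val-ϖ⁻¹ (val-powϖ⁻¹ m))

  val-ϖ^ : ∀ t → val (ϖ^ t) ≡ just t
  val-ϖ^ (+ m)    = val-powϖ m
  val-ϖ^ -[1+ m ] = val-powϖ⁻¹ m

module MatrixIdentities {c ℓ : Level} (F : NALocalField c ℓ) where
  open NALocalField F
  open LF F
  open IntegerCoefficientSolver cring

  -- 2×2 matrices of polynomials, multiplied by the formula used for M2, so
  -- that evaluating an entry of a symbolic product gives the entry of M2.
  record Symbolic (m : ℕ) : Set where
    constructor sym-mat
    field s11 s12 s21 s22 : Polynomial m
  open Symbolic

  _⊙_ : ∀ {m} → Symbolic m → Symbolic m → Symbolic m
  sym-mat a b c' d ⊙ sym-mat a' b' c'' d' =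
    sym-mat (a :* a' :+ b :* c'') (a :* b' :+ b :* d') (c' :* a' :+ d :* c'') (c' :* b' :+ d :* d')
  infixl 7 _⊙_

  :0 :1 : ∀ {m} → Polynomial m
  :0 = con (+ 0)
  :1 = con (+ 1)

  sym-det : ∀ {m} → Symbolic m → Polynomial m
  sym-det A = s11 A :* s22 A :- s12 A :* s21 A

  sym-a : ∀ {m} → Polynomial m → Symbolic m
  sym-a s = sym-mat s :0 :0 :1

  cellMatrix : Carrier → Carrier → Carrier → Carrier → M2 → M2
  cellMatrix z x T y A = zM z · nM x · aM T · wM · nM y · A

  sym-cell : ∀ {m} → (z x T y a b c' d : Polynomial m) → Symbolic m
  sym-cell z x T y a b c' d =
    sym-mat z :0 :0 z ⊙ sym-mat :1 x :0 :1 ⊙ sym-a T ⊙ sym-mat :0 :1 (:- :1) :0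
      ⊙ sym-mat :1 y :0 :1 ⊙ sym-mat a b c' d

  cell-e21 : ∀ z x T y A → e21 (cellMatrix z x T y A) ≈ - (z * (e11 A + y * e21 A))
  cell-e21 z x T y (mat a b c' d) =
    solve 8 (λ z x T y a b c' d → s21 (sym-cell z x T y a b c' d) := :- (z :* (a :+ y :* c')))
      refl z x T y a b c' d

  cell-e22 : ∀ z x T y A → e22 (cellMatrix z x T y A) ≈ - (z * (e12 A + y * e22 A))
  cell-e22 z x T y (mat a b c' d) =
    solve 8 (λ z x T y a b c' d → s22 (sym-cell z x T y a b c' d) := :- (z :* (b :+ y :* d)))
      refl z x T y a b c' d

  cell-det : ∀ z x T y A → det (cellMatrix z x T y A) ≈ z * z * T * det A
  cell-det z x T y (mat a b c' d) =
    solve 8 (λ z x T y a b c' d → sym-det (sym-cell z x T y a b c' d) := z :* z :* T :* sym-det (sym-mat a b c' d))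
      refl z x T y a b c' d

  Ka-e21 : ∀ A s → e21 (A · aM s) ≈ e21 A * s
  Ka-e21 (mat a b c' d) =
    solve 5 (λ a b c' d s → s21 (sym-mat a b c' d ⊙ sym-a s) := c' :* s) refl a b c' d

  Ka-e22 : ∀ A s → e22 (A · aM s) ≈ e22 A
  Ka-e22 (mat a b c' d) =
    solve 5 (λ a b c' d s → s22 (sym-mat a b c' d ⊙ sym-a s) := d) refl a b c' d

  Ka-det : ∀ A s → det (A · aM s) ≈ s * det A
  Ka-det (mat a b c' d) =
    solve 5 (λ a b c' d s → sym-det (sym-mat a b c' d ⊙ sym-a s) := s :* sym-det (sym-mat a b c' d))
      refl a b c' d

  det-cong : ∀ {A B} → A ≈M B → det A ≈ det B
  det-cong (p11 , p12 , p21 , p22) = +-cong (*-cong p11 p22) (-‿cong (*-cong p12 p21))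

module Integrality {c ℓ : Level} (F : NALocalField c ℓ) where
  open NALocalField F
  open LF F
  open ExtendedIntegers
  open Valuation F
  open IntegerCoefficientSolver cring using (solve; _:=_; _:+_; _:*_; _:-_; con)

  K-e11 : ∀ {A} → inK A → (+ 0) ≼ val (e11 A)
  K-e11 (a∈𝔬 , _) = a∈𝔬

  K-e12 : ∀ {A} → inK A → (+ 0) ≼ val (e12 A)
  K-e12 (_ , b∈𝔬 , _) = b∈𝔬

  K-e21 : ∀ {A} → inK A → (+ 0) ≼ val (e21 A)
  K-e21 (_ , _ , c∈𝔬 , _) = c∈𝔬

  K-e22 : ∀ {A} → inK A → (+ 0) ≼ val (e22 A)
  K-e22 (_ , _ , _ , d∈𝔬 , _) = d∈𝔬

  K-det : ∀ {A} → inK A → isUnit (det A)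
  K-det (_ , _ , _ , _ , det-unit) = det-unit

  -- The bottom row of a matrix in K contains a unit; otherwise the
  -- determinant would lie in 𝔭.
  primitive-bottom-row : ∀ A → inK A → isUnit (e21 A) ⊎ isUnit (e22 A)
  primitive-bottom-row (mat a b c' d) (a∈𝔬 , b∈𝔬 , c∈𝔬 , d∈𝔬 , det-unit)
    with ≼-split (val c') c∈𝔬 | ≼-split (val d) d∈𝔬
  ... | inj₁ c-unit | _          = inj₁ c-unit
  ... | inj₂ _      | inj₁ d-unit = inj₂ d-unit
  ... | inj₂ c∈𝔭    | inj₂ d∈𝔭    = ⊥-elim (1≰0 (≼-resp det-unit det∈𝔭))
    where
    det∈𝔭 : (+ 1) ≼ val (a * d - b * c')
    det∈𝔭 = val-ultra (+ 1) (a * d) (- (b * c'))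
      (val-*-≼ a d a∈𝔬 d∈𝔭) (val-neg-≼ (b * c') (val-*-≼ b c' b∈𝔬 c∈𝔭))

  module BottomRow (n l : ℕ) (l≤n : l ℕ.≤ n) (y : Carrier) (val-y : val y ≡ just (ℤ.- (+ l))) where

    y-times-𝔭ⁿ : ∀ x → (+ n) ≼ val x → (+ (n ℕ.∸ l)) ≼ val (y * x)
    y-times-𝔭ⁿ x x∈𝔭ⁿ = ≡.subst (_≼ val (y * x)) -l+n≡n-l (val-*-≼ y x (≼-val val-y) x∈𝔭ⁿ)
      where
      -l+n≡n-l : ℤ.- (+ l) ℤ.+ (+ n) ≡ + (n ℕ.∸ l)
      -l+n≡n-l = ≡.trans (ℤP.-m+n≡n⊖m l n) (ℤP.⊖-≥ l≤n)

    first-integral : ∀ {A} → inK1 n A → (+ 0) ≼ val (e11 A + y * e21 A)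
    first-integral {mat a b c' d} (A∈K , c∈𝔭ⁿ , _) =
      val-ultra (+ 0) a (y * c') (K-e11 A∈K) (≼-weaken (val (y * c')) (ℤ.+≤+ ℕ.z≤n) (y-times-𝔭ⁿ c' c∈𝔭ⁿ))

    first-unit : ∀ {A} → inK1 n A → l ℕ.< n → isUnit (e11 A + y * e21 A)
    first-unit {mat a b c' d} (_ , c∈𝔭ⁿ , a-1∈𝔭ⁿ) l<n =
      ≡.trans (val-resp shift) (unit-plus ((a - 1#) + y * c') rest∈𝔭)
      where
      shift : a + y * c' ≈ 1# + ((a - 1#) + y * c')
      shift = solve 3 (λ y a c' → a :+ y :* c' := con (+ 1) :+ ((a :- con (+ 1)) :+ y :* c')) refl y a c'
      rest∈𝔭 : (+ 1) ≼ val ((a - 1#) + y * c')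
      rest∈𝔭 = val-ultra (+ 1) (a - 1#) (y * c')
        (≼-weaken (val (a - 1#)) (ℤ.+≤+ (ℕP.≤-trans (ℕ.s≤s ℕ.z≤n) l<n)) a-1∈𝔭ⁿ)
        (≼-weaken (val (y * c')) (ℤ.+≤+ (ℕP.m<n⇒0<n∸m l<n)) (y-times-𝔭ⁿ c' c∈𝔭ⁿ))

    second-bound : ∀ {A} → inK1 n A → (ℤ.- (+ l)) ≼ val (e12 A + y * e22 A)
    second-bound {mat a b c' d} (A∈K , _) = val-ultra (ℤ.- (+ l)) b (y * d)
      (≼-weaken (val b) ℤP.neg-≤-pos (K-e12 A∈K))
      (≡.subst (_≼ val (y * d)) (ℤP.+-identityʳ _) (val-*-≼ y d (≼-val val-y) (K-e22 A∈K)))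

module CellValuation {c ℓ : Level} (F : NALocalField c ℓ) where
  open NALocalField F
  open LF F
  open ExtendedIntegers
  open Valuation F
  open MatrixIdentities F
  open Integrality F
  open IntegerCoefficientSolver cring using (solve; _:=_; _:+_; _:*_; _:-_)
  open ≡.≡-Reasoning

  module Comparison (n : ℕ) (t : ℤ) (l : ℕ) (v z x : Carrier) (g k k₁ : M2)
      (l≤n : l ℕ.≤ n) (v-unit : isUnit v) (z≉0 : ¬ (z ≈ 0#))
      (k∈K : inK k) (k₁∈K₁ : inK1 n k₁)
      (g≈ka : g ≈M (k · aM (ϖ^ (+ ⌈ n /2⌉))))
      (g≈cell : g ≈M cellMatrix z x (ϖ^ t) (ϖ^ (ℤ.- (+ l)) * v) k₁) where

    n₁ : ℕ
    n₁ = ⌈ n /2⌉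

    S T y P Q : Carrier
    S = ϖ^ (+ n₁)
    T = ϖ^ t
    y = ϖ^ (ℤ.- (+ l)) * v
    P = e11 k₁ + y * e21 k₁
    Q = e12 k₁ + y * e22 k₁

    val-y : val y ≡ just (ℤ.- (+ l))
    val-y = ≡.trans (val-*-unit (ϖ^ (ℤ.- (+ l))) v-unit) (val-ϖ^ (ℤ.- (+ l)))

    open BottomRow n l l≤n y val-y

    V : ℤ
    V = proj₁ (val-finite z z≉0)

    val-z : val z ≡ just V
    val-z = proj₂ (val-finite z z≉0)

    bottom-left : - (z * P) ≈ e21 k * S
    bottom-left = trans (sym (cell-e21 z x T y k₁))
      (trans (sym (proj₁ (proj₂ (proj₂ g≈cell)))) (trans (proj₁ (proj₂ (proj₂ g≈ka))) (Ka-e21 k S)))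

    bottom-right : - (z * Q) ≈ e22 k
    bottom-right = trans (sym (cell-e22 z x T y k₁))
      (trans (sym (proj₂ (proj₂ (proj₂ g≈cell)))) (trans (proj₂ (proj₂ (proj₂ g≈ka))) (Ka-e22 k S)))

    determinants : z * z * T * det k₁ ≈ S * det k
    determinants = trans (sym (cell-det z x T y k₁))
      (trans (sym (det-cong g≈cell)) (trans (det-cong g≈ka) (Ka-det k S)))

    val-zP : val (z * P) ≡ val (e21 k) +∞ just (+ n₁)
    val-zP = begin
      val (z * P)              ≡⟨ val-neg (z * P) ⟨
      val (- (z * P))          ≡⟨ val-resp bottom-left ⟩
      val (e21 k * S)          ≡⟨ val-mul (e21 k) S ⟩
      val (e21 k) +∞ val S     ≡⟨ ≡.cong (val (e21 k) +∞_) (val-ϖ^ (+ n₁)) ⟩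
      val (e21 k) +∞ just (+ n₁) ∎

    val-zQ : val (z * Q) ≡ val (e22 k)
    val-zQ = ≡.trans (≡.sym (val-neg (z * Q))) (val-resp bottom-right)

    zP-bound : (+ n₁) ≼ val (z * P)
    zP-bound = ≼-resp (≡.sym val-zP) (≼-+∞ (val (e21 k)) (just (+ n₁)) (K-e21 k∈K) ℤP.≤-refl)

    zQ-integral : (+ 0) ≼ val (z * Q)
    zQ-integral = ≼-resp (≡.sym val-zQ) (K-e22 k∈K)

    det-equation : (V ℤ.+ V) ℤ.+ t ≡ + n₁
    det-equation = just-injective (begin
      just ((V ℤ.+ V) ℤ.+ t)         ≡⟨ ≡.cong₂ _+∞_ (≡.cong₂ _+∞_ val-z val-z) (val-ϖ^ t) ⟨
      (val z +∞ val z) +∞ val T      ≡⟨ ≡.cong (_+∞ val T) (val-mul z z) ⟨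
      val (z * z) +∞ val T           ≡⟨ val-mul (z * z) T ⟨
      val (z * z * T)                ≡⟨ val-*-unit (z * z * T) (K-det (proj₁ k₁∈K₁)) ⟨
      val (z * z * T * det k₁)       ≡⟨ val-resp determinants ⟩
      val (S * det k)                ≡⟨ val-*-unit S (K-det k∈K) ⟩
      val S                          ≡⟨ val-ϖ^ (+ n₁) ⟩
      just (+ n₁)                    ∎)

    -- l ≤ V: the element z y det k₁ = (zQ) e11 k₁ - (zP) e12 k₁ is
    -- integral and has valuation V - l.
    l≤V : + l ℤ.≤ V
    l≤V = ℤP.0≤i-j⇒j≤i (≼-resp val-zydet (≼-resp (val-resp (sym expansion)) integral))
      where
      expansion : z * (y * det k₁) ≈ (z * Q) * e11 k₁ - (z * P) * e12 k₁
      expansion = solve 6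
        (λ z y a b c' d → z :* (y :* (a :* d :- b :* c')) := (z :* (b :+ y :* d)) :* a :- (z :* (a :+ y :* c')) :* b)
        refl z y (e11 k₁) (e12 k₁) (e21 k₁) (e22 k₁)
      val-zydet : val (z * (y * det k₁)) ≡ just (V ℤ.- + l)
      val-zydet = ≡.trans (val-mul z (y * det k₁))
        (≡.cong₂ _+∞_ val-z (≡.trans (val-*-unit y (K-det (proj₁ k₁∈K₁))) val-y))
      integral : (+ 0) ≼ val ((z * Q) * e11 k₁ - (z * P) * e12 k₁)
      integral = val-ultra (+ 0) _ _
        (val-*-≼ (z * Q) (e11 k₁) zQ-integral (K-e11 (proj₁ k₁∈K₁)))
        (val-neg-≼ _ (val-*-≼ (z * P) (e12 k₁)
          (≼-weaken (val (z * P)) (ℤ.+≤+ ℕ.z≤n) zP-bound) (K-e12 (proj₁ k₁∈K₁))))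

    -- n₁ ≤ V: for l < n, P is a unit so V = val (zP) ≥ n₁; for l = n use l ≤ V.
    n₁≤V : + n₁ ℤ.≤ V
    n₁≤V with l ℕ.<? n
    ... | yes l<n = ≼-resp (≡.trans (val-*-unit z (first-unit k₁∈K₁ l<n)) val-z) zP-bound
    ... | no l≮n  = ℤP.≤-trans (ℤ.+≤+ (ℕP.⌈n/2⌉≤n n)) (ℤP.≤-trans (ℤ.+≤+ (ℕP.≮⇒≥ l≮n)) l≤V)

    -- V ≤ l or V ≤ n₁, according to which entry of the bottom row of k is a unit.
    V≤l⊎V≤n₁ : V ℤ.≤ + l ⊎ V ℤ.≤ + n₁
    V≤l⊎V≤n₁ with primitive-bottom-row k k∈K
    ... | inj₁ c-unit = inj₂ (≡.subst (ℤ._≤ + n₁) (ℤP.+-identityʳ V)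
            (≼-resp (≡.trans val-zP (≡.cong (_+∞ just (+ n₁)) c-unit))
              (val-*-≼ z P (≼-val val-z) (first-integral k₁∈K₁))))
    ... | inj₂ d-unit = inj₁ (ℤP.i-j≤0⇒i≤j
            (≼-resp (≡.trans val-zQ d-unit) (val-*-≼ z Q (≼-val val-z) (second-bound k₁∈K₁))))

mainTheorem9 : {c ℓ : Level} (F : NALocalField c ℓ) →
    let open NALocalField F in
    let open LF F in
    (n : ℕ) (g : M2) → inKa ⌈ n /2⌉ g →
    (t : ℤ) (l : ℕ) (v : Carrier) → l ℕ.≤ n → isUnit v → inCell n g t l v →
    t ≡ ((+ ⌈ n /2⌉) ℤ.- (+ (2 ℕ.* l))) ℤ.⊓ (ℤ.- (+ ⌈ n /2⌉))
mainTheorem9 F n g (k , k∈K , g≈ka) t l v l≤n v-unit (z , x , k₁ , z≉0 , k₁∈K₁ , g≈cell) =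
  t-closed-form ⌈ n /2⌉ l V t det-equation l≤V n₁≤V V≤l⊎V≤n₁
  where
  open IntegerArithmetic using (t-closed-form)
  open CellValuation.Comparison F n t l v z x g k k₁ l≤n v-unit z≉0 k∈K k₁∈K₁ g≈ka g≈cell
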